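{- Let $p$ be an odd prime and let $S$ be the support of a word of $C_p$. For a point $x$ of $\pi_p$ define $S_x=\{y\in S: x\vee y \text{ is a tangent to } S\}$ if $x\notin S$, and $S_x=\{y\in S: y\neq x \text{ and } x\vee y \text{ is a secant to } S\}$ if $x\in S$. Then $S_x$ is contained in a line of $\pi_p$.
   Context: $\pi_p$ is the projective plane over $\mathbb{F}_p=\mathbb{Z}/p\mathbb{Z}$ with point set $P$; lines are identified with their indicator functions in $\mathbb{F}_p^P$, and $C_p$ is the $\mathbb{F}_p$-span of the lines. The support of $w\in\mathbb{F}_p^P$ is $\{x: w(x)\neq 0\}$. For distinct points $x,y$, $x\vee y$ is the line through them. For a point set $S$, a line $\ell$ is a passant, tangent or secant to $S$ if $|S\cap \ell|$ is $0$, $1$ or $2$ respectively. -}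

module Defs where

open import Data.Nat using (ℕ; _+_; _*_)
open import Data.Nat.Divisibility using (_∣_; _∣?_)
open import Data.Fin using (Fin; toℕ)
open import Data.Nat.ListAction using (sum)
open import Data.List using (List; []; _∷_; map; _++_; concatMap; filter; length; allFin)
open import Data.Product using (_×_; _,_; ∃)
open import Relation.Nullary using (¬_; Dec; yes; no)
open import Relation.Nullary.Decidable using (¬?; _×-dec_)
open import Relation.Binary.PropositionalEquality using (_≡_; _≢_)

-- Points of the projective plane PG(2,p) = π_p, as normalised homogeneous
-- coordinates: (1,a,b), (0,1,a), (0,0,1).  Lines are represented the same
-- way (dual coordinates [u0,u1,u2]); a point x lies on a line u iff
-- u0 x0 + u1 x1 + u2 x2 ≡ 0 (mod p).
data Pt (p : ℕ) : Set where
  pt₁ : Fin p → Fin p → Pt p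
  pt₂ : Fin p → Pt p
  pt₃ : Pt p

Line : ℕ → Set
Line = Pt

coords : ∀ {p} → Pt p → ℕ × ℕ × ℕ
coords (pt₁ a b) = 1 , toℕ a , toℕ b
coords (pt₂ a)   = 0 , 1 , toℕ a
coords pt₃       = 0 , 0 , 1

dot : ℕ × ℕ × ℕ → ℕ × ℕ × ℕ → ℕ
dot (a , b , c) (x , y , z) = a * x + b * y + c * z

_∈L_ : ∀ {p} → Pt p → Line p → Set
_∈L_ {p} x ℓ = p ∣ dot (coords ℓ) (coords x)

_∈L?_ : ∀ {p} (x : Pt p) (ℓ : Line p) → Dec (x ∈L ℓ)
_∈L?_ {p} x ℓ = p ∣? dot (coords ℓ) (coords x)

allPts : (p : ℕ) → List (Pt p)
allPts p = concatMap (λ a → map (pt₁ a) (allFin p)) (allFin p)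
           ++ map pt₂ (allFin p) ++ (pt₃ ∷ [])

allLines : (p : ℕ) → List (Line p)
allLines = allPts

ind : ∀ {p} → Line p → Pt p → ℕ
ind ℓ x with x ∈L? ℓ
... | yes _ = 1
... | no _  = 0

-- The word  w = Σ_ℓ c(ℓ)·1_ℓ  of C_p determined by coefficients c : Line → F_p;
-- its value at x is given by this natural number reduced mod p.
wordVal : ∀ {p} → (Line p → Fin p) → Pt p → ℕ
wordVal {p} c x = sum (map (λ ℓ → toℕ (c ℓ) * ind ℓ x) (allLines p))

InSupp : ∀ {p} → (Line p → Fin p) → Pt p → Set
InSupp {p} c x = ¬ (p ∣ wordVal c x)

InSupp? : ∀ {p} (c : Line p → Fin p) (x : Pt p) → Dec (InSupp c x)
InSupp? {p} c x = ¬? (p ∣? wordVal c x)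

meet : ∀ {p} → (Line p → Fin p) → Line p → ℕ
meet {p} c ℓ = length (filter (λ y → InSupp? c y ×-dec (y ∈L? ℓ)) (allPts p))

Tangent Secant : ∀ {p} → (Line p → Fin p) → Line p → Set
Tangent c ℓ = meet c ℓ ≡ 1
Secant  c ℓ = meet c ℓ ≡ 2

-- ℓ is the line x ∨ y (for distinct points x, y it is the unique line through both)
IsJoin : ∀ {p} → Pt p → Pt p → Line p → Set
IsJoin x y ℓ = x ∈L ℓ × y ∈L ℓ

InSx : ∀ {p} → (Line p → Fin p) → Pt p → Pt p → Set
InSx c x y with InSupp? c x
... | no  _ = InSupp c y × y ≢ x × ∃ (λ ℓ → IsJoin x y ℓ × Tangent c ℓ)
... | yes _ = InSupp c y × y ≢ x × ∃ (λ ℓ → IsJoin x y ℓ × Secant c ℓ)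

module Submission where

open import Defs
open import Data.Fin using (Fin; toℕ)
open import Data.Fin.Properties using (toℕ-fromℕ<; toℕ-injective; toℕ<n)
open import Data.Nat using (ℕ; zero; suc; pred; _+_; _*_; _≤_; _<_; z≤n; s≤s; s≤s⁻¹; z<s; NonZero; >-nonZero; _%_; nonTrivial⇒n>1)
open import Data.Nat.Properties
open import Data.Nat.DivMod
open import Data.Nat.Divisibility
open import Data.Nat.Primality using (Prime; prime[2]; ¬prime[1]; prime⇒nonZero; prime⇒nonTrivial; prime⇒irreducible; euclidsLemma)
open import Data.Nat.Coprimality using (Coprime; coprime-Bézout)
open import Data.Nat.GCD using (module Bézout)
open import Data.Empty using (⊥-elim)
open import Data.Sum using (inj₁; inj₂)
open import Data.List using (List; []; _∷_; map; length; filter; allFin; concatMap; _++_)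
open import Data.Nat.ListAction using (sum)
open import Data.List.Membership.Propositional using (_∈_; lose)
open import Data.List.Membership.Propositional.Properties
  using (∈-filter⁺; ∈-map⁺; ∈-++⁺ˡ; ∈-++⁺ʳ; ∈-concatMap⁺; ∈-allFin)
open import Data.List.Relation.Unary.Any using (here; there)
open import Data.List.Relation.Unary.All as All using (All; []; _∷_)
open import Data.List.Relation.Unary.Unique.Propositional using (Unique)
open import Data.List.Relation.Unary.AllPairs using ([]; _∷_)
open import Data.Product using (Σ; _×_; _,_; proj₁; proj₂; ∃)
open import Relation.Nullary using (¬_; Dec; yes; no; contradiction)
open import Relation.Nullary.Decidable using (_×-dec_)
open import Relation.Binary.PropositionalEquality
open import Data.Nat.Tactic.RingSolver using (solve-∀)
open import Relation.Binary.Bundles using (Setoid)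
import Relation.Binary.Reasoning.Setoid
open import Level using (0ℓ)
open import Algebra.Properties.CommutativeSemigroup +-commutativeSemigroup using ()
  renaming (interchange to +-interchange)
open import Algebra.Properties.CommutativeSemigroup *-commutativeSemigroup using ()
  renaming (x∙yz≈y∙xz to *-leftComm)


-- With dual coordinates put
--     K = Σ_{m ∌ x} c(m) · ⟨m,x⟩⁻¹ · m .
-- Every y ∈ S_x satisfies ⟨K,x⟩ ≡ w(y) ≢ 0 and ⟨K,y⟩ ≡ 0, so S_x lies on the
-- line K (and S_x is empty when ⟨K,x⟩ ≡ 0).
-- For y ≢ x the points of x ∨ y other than x are z_t = ⟨y + t·x⟩ (t ∈ F_p),
-- with z_0 = y, and z_t lies on a line m iff ⟨m,y⟩ + t·⟨m,x⟩ ≡ 0.  Exchanging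
-- the sums over t and over m gives
--     Σ_t w(z_t) ≡ ⟨K,x⟩    and    ⟨K,y⟩ + Σ_t t·w(z_t) ≡ 0 ,
-- where x ∨ y itself contributes Σ_t 1 = p ≡ 0 and Σ_t t = p(p-1)/2 ≡ 0 (p odd).
-- If y ∈ S_x, the tangent (x ∉ S) or secant (x ∈ S) condition makes y the only
-- z_t in S, so the two sums reduce to w(y) and 0.
-- The file develops in turn: counting points of S on a line, finite sums,
-- arithmetic modulo p, homogeneous coordinates, the solutions of b + t·a ≡ 0,
-- the points z_t of a join, the line K with the two identities, the theorem.

remove : {A : Set} {a : A} (xs : List A) → a ∈ xs → List A
remove (x ∷ xs) (here _)  = xs
remove (x ∷ xs) (there h) = x ∷ remove xs h

length-remove : {A : Set} {a : A} (xs : List A) (h : a ∈ xs) →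
                length xs ≡ suc (length (remove xs h))
length-remove (x ∷ xs) (here _)  = refl
length-remove (x ∷ xs) (there h) = cong suc (length-remove xs h)

∈-remove : {A : Set} {a b : A} {xs : List A} → b ∈ xs → b ≢ a → (h : a ∈ xs) → b ∈ remove xs h
∈-remove (here b≡x)  b≢a (here a≡x) = contradiction (trans b≡x (sym a≡x)) b≢a
∈-remove (here b≡x)  _   (there _)  = here b≡x
∈-remove (there b∈)  _   (here _)   = b∈
∈-remove (there b∈)  b≢a (there h)  = there (∈-remove b∈ b≢a h)

-- A duplicate-free list all of whose members occur in xs is no longer than xs.
-- This is how distinct points of S on a line bound |S ∩ ℓ| from below.
unique⊆⇒length≤ : {A : Set} {ys xs : List A} → Unique ys → All (_∈ xs) ys → length ys ≤ length xs
unique⊆⇒length≤ [] [] = z≤n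
unique⊆⇒length≤ {xs = xs} (y≢ys ∷ ys-unique) (y∈xs ∷ ys∈xs) =
  subst (_ ≤_) (sym (length-remove xs y∈xs))
    (s≤s (unique⊆⇒length≤ ys-unique
      (All.zipWith (λ (z∈xs , y≢z) → ∈-remove z∈xs (≢-sym y≢z) y∈xs) (ys∈xs , y≢ys))))

allPts-complete : ∀ {p} (z : Pt p) → z ∈ allPts p
allPts-complete {p} (pt₁ a b) =
  ∈-++⁺ˡ (∈-concatMap⁺ (λ a → map (pt₁ a) (allFin p)) (lose (∈-allFin a) (∈-map⁺ (pt₁ a) (∈-allFin b))))
allPts-complete {p} (pt₂ a) =
  ∈-++⁺ʳ (concatMap (λ a → map (pt₁ a) (allFin p)) (allFin p)) (∈-++⁺ˡ (∈-map⁺ pt₂ (∈-allFin a)))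
allPts-complete {p} pt₃ =
  ∈-++⁺ʳ (concatMap (λ a → map (pt₁ a) (allFin p)) (allFin p)) (∈-++⁺ʳ (map pt₂ (allFin p)) (here refl))

vanishes-off-saturated-line :
  ∀ {p} (c : Line p → Fin p) (ℓ : Line p) (zs : List (Pt p)) →
  Unique zs → All (λ z → InSupp c z × z ∈L ℓ) zs → meet c ℓ ≡ length zs →
  ∀ {z} → z ∈L ℓ → All (z ≢_) zs → p ∣ wordVal c z
vanishes-off-saturated-line {p} c ℓ zs zs-unique zs∈S∩ℓ |S∩ℓ|≡ {z} z∈ℓ z∉zs
  with p ∣? wordVal c z
... | yes p∣w = p∣w
... | no z∈S = contradiction (subst (length zs <_) |S∩ℓ|≡ z∷zs≤|S∩ℓ|) (n≮n (length zs))
  where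
  z∷zs≤|S∩ℓ| : suc (length zs) ≤ meet c ℓ
  z∷zs≤|S∩ℓ| = unique⊆⇒length≤ (z∉zs ∷ zs-unique)
    (All.map (∈-filter⁺ (λ y → InSupp? c y ×-dec (y ∈L? ℓ)) (allPts-complete _)) ((z∈S , z∈ℓ) ∷ zs∈S∩ℓ))

Σ< : ℕ → (ℕ → ℕ) → ℕ
Σ< zero    f = 0
Σ< (suc n) f = Σ< n f + f n

Σ-over : {A : Set} → List A → (A → ℕ) → ℕ
Σ-over xs f = sum (map f xs)

Σ<-cong : ∀ n {f g} → (∀ t → t < n → f t ≡ g t) → Σ< n f ≡ Σ< n g
Σ<-cong zero    f≡g = refl
Σ<-cong (suc n) f≡g = cong₂ _+_ (Σ<-cong n (λ t t<n → f≡g t (m<n⇒m<1+n t<n))) (f≡g n ≤-refl)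

Σ<-*ˡ : ∀ n k f → Σ< n (λ t → k * f t) ≡ k * Σ< n f
Σ<-*ˡ zero    k f = sym (*-zeroʳ k)
Σ<-*ˡ (suc n) k f = trans (cong (_+ k * f n) (Σ<-*ˡ n k f)) (sym (*-distribˡ-+ k (Σ< n f) (f n)))

Σ-over-cong : {A : Set} (xs : List A) {f g : A → ℕ} → (∀ x → f x ≡ g x) → Σ-over xs f ≡ Σ-over xs g
Σ-over-cong []       f≡g = refl
Σ-over-cong (x ∷ xs) f≡g = cong₂ _+_ (f≡g x) (Σ-over-cong xs f≡g)

Σ-over-+ : {A : Set} (xs : List A) (f g : A → ℕ) →
           Σ-over xs (λ x → f x + g x) ≡ Σ-over xs f + Σ-over xs g
Σ-over-+ []       f g = refl
Σ-over-+ (x ∷ xs) f g =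
  trans (cong (f x + g x +_) (Σ-over-+ xs f g)) (+-interchange (f x) (g x) (Σ-over xs f) (Σ-over xs g))

Σ-over-*ˡ : {A : Set} (xs : List A) (k : ℕ) (f : A → ℕ) → Σ-over xs (λ x → k * f x) ≡ k * Σ-over xs f
Σ-over-*ˡ []       k f = sym (*-zeroʳ k)
Σ-over-*ˡ (x ∷ xs) k f = trans (cong (k * f x +_) (Σ-over-*ˡ xs k f)) (sym (*-distribˡ-+ k (f x) _))

Σ<-Σ-over : {A : Set} (n : ℕ) (xs : List A) (F : ℕ → A → ℕ) →
            Σ< n (λ t → Σ-over xs (F t)) ≡ Σ-over xs (λ x → Σ< n (λ t → F t x))
Σ<-Σ-over zero    xs F = sym (Σ-over-zero xs)
  where
  Σ-over-zero : ∀ xs → Σ-over xs (λ _ → 0) ≡ 0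
  Σ-over-zero []       = refl
  Σ-over-zero (_ ∷ xs) = Σ-over-zero xs
Σ<-Σ-over (suc n) xs F =
  trans (cong (_+ Σ-over xs (F n)) (Σ<-Σ-over n xs F)) (sym (Σ-over-+ xs (λ x → Σ< n (λ t → F t x)) (F n)))

Σ<-ones : ∀ n → Σ< n (λ _ → 1) ≡ n
Σ<-ones zero    = refl
Σ<-ones (suc n) = trans (cong (_+ 1) (Σ<-ones n)) (+-comm n 1)

Σ<-id : ∀ n → Σ< (suc n) (λ t → t) * 2 ≡ suc n * n
Σ<-id zero    = refl
Σ<-id (suc n) = begin
  (Σ< (suc n) (λ t → t) + suc n) * 2      ≡⟨ *-distribʳ-+ 2 (Σ< (suc n) (λ t → t)) (suc n) ⟩
  Σ< (suc n) (λ t → t) * 2 + suc n * 2    ≡⟨ cong (_+ suc n * 2) (Σ<-id n) ⟩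
  suc n * n + suc n * 2                   ≡⟨ *-distribˡ-+ (suc n) n 2 ⟨
  suc n * (n + 2)                         ≡⟨ *-comm (suc n) (n + 2) ⟩
  (n + 2) * suc n                         ≡⟨ cong (_* suc n) (+-comm n 2) ⟩
  suc (suc n) * suc n                     ∎
  where open ≡-Reasoning

𝟙 : {P : Set} → Dec P → ℕ
𝟙 (yes _) = 1
𝟙 (no _)  = 0

𝟙-cong : {P Q : Set} → (P → Q) → (Q → P) → (P? : Dec P) (Q? : Dec Q) → 𝟙 P? ≡ 𝟙 Q?
𝟙-cong P⇒Q Q⇒P (yes _) (yes _) = refl
𝟙-cong P⇒Q Q⇒P (yes P) (no ¬Q) = contradiction (P⇒Q P) ¬Q
𝟙-cong P⇒Q Q⇒P (no ¬P) (yes Q) = contradiction (Q⇒P Q) ¬P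
𝟙-cong P⇒Q Q⇒P (no _)  (no _)  = refl

ind≡𝟙 : ∀ {p} (ℓ : Line p) z → ind ℓ z ≡ 𝟙 (z ∈L? ℓ)
ind≡𝟙 ℓ z with z ∈L? ℓ
... | yes _ = refl
... | no _  = refl

Σ<-none : ∀ n (g : ℕ → ℕ) {P : ℕ → Set} (P? : ∀ t → Dec (P t)) →
          (∀ t → t < n → ¬ P t) → Σ< n (λ t → g t * 𝟙 (P? t)) ≡ 0
Σ<-none zero    g P? ¬P = refl
Σ<-none (suc n) g P? ¬P with P? n
... | yes Pn = contradiction Pn (¬P n ≤-refl)
... | no _   = cong₂ _+_ (Σ<-none n g P? (λ t t<n → ¬P t (m<n⇒m<1+n t<n))) (*-zeroʳ (g n))

Σ<-unique : ∀ n (g : ℕ → ℕ) {P : ℕ → Set} (P? : ∀ t → Dec (P t)) t₀ → t₀ < n → P t₀ →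
            (∀ t → t < n → P t → t ≡ t₀) → Σ< n (λ t → g t * 𝟙 (P? t)) ≡ g t₀
Σ<-unique (suc n) g P? t₀ t₀<1+n Pt₀ unique with P? n
... | yes Pn with unique n ≤-refl Pn
...   | refl = cong₂ _+_ (Σ<-none n g P? (λ t t<n Pt → <-irrefl (unique t (m<n⇒m<1+n t<n) Pt) t<n))
                         (*-identityʳ (g n))
Σ<-unique (suc n) g {P} P? t₀ t₀<1+n Pt₀ unique | no ¬Pn =
  trans (cong₂ _+_ (Σ<-unique n g P? t₀ (≤∧≢⇒< (s≤s⁻¹ t₀<1+n) (λ t₀≡n → ¬Pn (subst P t₀≡n Pt₀))) Pt₀
                                (λ t t<n Pt → unique t (m<n⇒m<1+n t<n) Pt))
                    (*-zeroʳ (g n)))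
        (+-identityʳ (g t₀))

-- Congruence modulo a nonzero p, the equality of F_p on representatives in ℕ.
-- Negation is multiplication by p ∸ 1, since b + (p ∸ 1) * b = p * b.
module Modular (p : ℕ) .{{_ : NonZero p}} where

  infix 4 _≋_
  _≋_ : ℕ → ℕ → Set
  a ≋ b = a % p ≡ b % p

  ≋-setoid : Setoid 0ℓ 0ℓ
  ≋-setoid = record
    { Carrier = ℕ ; _≈_ = _≋_
    ; isEquivalence = record { refl = refl ; sym = sym ; trans = trans } }

  module ≋-Reasoning = Relation.Binary.Reasoning.Setoid ≋-setoid

  ≡⇒≋ : ∀ {a b} → a ≡ b → a ≋ b
  ≡⇒≋ = cong (_% p)

  +-cong≋ : ∀ {a a′ b b′} → a ≋ a′ → b ≋ b′ → a + b ≋ a′ + b′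
  +-cong≋ {a} {a′} {b} {b′} e f = begin
    (a + b) % p              ≡⟨ %-distribˡ-+ a b p ⟩
    (a % p + b % p) % p      ≡⟨ cong₂ (λ u v → (u + v) % p) e f ⟩
    (a′ % p + b′ % p) % p    ≡⟨ %-distribˡ-+ a′ b′ p ⟨
    (a′ + b′) % p            ∎
    where open ≡-Reasoning

  *-cong≋ : ∀ {a a′ b b′} → a ≋ a′ → b ≋ b′ → a * b ≋ a′ * b′
  *-cong≋ {a} {a′} {b} {b′} e f = begin
    (a * b) % p              ≡⟨ %-distribˡ-* a b p ⟩
    (a % p * (b % p)) % p    ≡⟨ cong₂ (λ u v → (u * v) % p) e f ⟩
    (a′ % p * (b′ % p)) % p  ≡⟨ %-distribˡ-* a′ b′ p ⟨
    (a′ * b′) % p            ∎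
    where open ≡-Reasoning

  +-congˡ≋ : ∀ a {b b′} → b ≋ b′ → a + b ≋ a + b′
  +-congˡ≋ a = +-cong≋ {a} refl

  *-congˡ≋ : ∀ a {b b′} → b ≋ b′ → a * b ≋ a * b′
  *-congˡ≋ a = *-cong≋ {a} refl

  *-congʳ≋ : ∀ b {a a′} → a ≋ a′ → a * b ≋ a′ * b
  *-congʳ≋ b e = *-cong≋ e (refl {x = b % p})

  %≋ : ∀ a → a % p ≋ a
  %≋ a = m%n%n≡m%n a p

  0%p≡0 : 0 % p ≡ 0
  0%p≡0 = m*n%n≡0 0 p

  ∣⇒≋0 : ∀ {a} → p ∣ a → a ≋ 0
  ∣⇒≋0 {a} p∣a = trans (n∣m⇒m%n≡0 a p p∣a) (sym 0%p≡0)

  ≋0⇒∣ : ∀ {a} → a ≋ 0 → p ∣ a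
  ≋0⇒∣ {a} a≋0 = m%n≡0⇒n∣m a p (trans a≋0 0%p≡0)

  neg : ℕ → ℕ
  neg b = pred p * b

  +-neg≋0 : ∀ b → b + neg b ≋ 0
  +-neg≋0 b = ∣⇒≋0 (subst (λ n → p ∣ n * b) (sym (suc-pred p)) (∣m⇒∣m*n b ∣-refl))

  move : ∀ {a b c} → a + b ≋ c → a ≋ c + neg b
  move {a} {b} {c} a+b≋c = begin
    a                  ≡⟨ +-identityʳ a ⟨
    a + 0              ≈⟨ +-congˡ≋ a (+-neg≋0 b) ⟨
    a + (b + neg b)    ≡⟨ +-assoc a b (neg b) ⟨
    a + b + neg b      ≈⟨ +-cong≋ a+b≋c (refl {x = neg b % p}) ⟩
    c + neg b          ∎
    where open ≋-Reasoning

  +-cancelʳ≋ : ∀ {a b c} → a + c ≋ b + c → a ≋ b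
  +-cancelʳ≋ {a} {b} {c} e = begin
    a                  ≈⟨ move e ⟩
    b + c + neg c      ≡⟨ +-assoc b c (neg c) ⟩
    b + (c + neg c)    ≈⟨ +-congˡ≋ b (+-neg≋0 c) ⟩
    b + 0              ≡⟨ +-identityʳ b ⟩
    b                  ∎
    where open ≋-Reasoning

  ≋⇒≡ : ∀ {a b} → a < p → b < p → a ≋ b → a ≡ b
  ≋⇒≡ a<p b<p a≋b = trans (sym (m<n⇒m%n≡m a<p)) (trans a≋b (m<n⇒m%n≡m b<p))

  Σ-over-cong≋ : {A : Set} (xs : List A) {f g : A → ℕ} → (∀ x → f x ≋ g x) → Σ-over xs f ≋ Σ-over xs g
  Σ-over-cong≋ []       f≋g = refl
  Σ-over-cong≋ (x ∷ xs) f≋g = +-cong≋ (f≋g x) (Σ-over-cong≋ xs f≋g)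

  Σ-over-≋0 : {A : Set} (xs : List A) {f : A → ℕ} → (∀ x → f x ≋ 0) → Σ-over xs f ≋ 0
  Σ-over-≋0 []       f≋0 = refl
  Σ-over-≋0 (x ∷ xs) f≋0 = +-cong≋ (f≋0 x) (Σ-over-≋0 xs f≋0)

  Σ<-first : ∀ n (f : ℕ → ℕ) → (∀ t → 0 < t → t < suc n → f t ≋ 0) → Σ< (suc n) f ≋ f 0
  Σ<-first zero    f f≋0 = refl
  Σ<-first (suc n) f f≋0 =
    trans (+-cong≋ (Σ<-first n f (λ t 0<t t<1+n → f≋0 t 0<t (m<n⇒m<1+n t<1+n))) (f≋0 (suc n) z<s ≤-refl))
          (≡⇒≋ (+-identityʳ (f 0)))

-- Modulo a prime every nonzero class has an inverse; we extend the inverse by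
-- 0⁻¹ = 0 so that it is a total function on representatives.
module PrimeField (p : ℕ) (p-prime : Prime p) where

  instance
    p≢0 : NonZero p
    p≢0 = prime⇒nonZero p-prime

  open Modular p public

  1≉0 : ¬ 1 ≋ 0
  1≉0 1≋0 = <⇒≱ (nonTrivial⇒n>1 p {{prime⇒nonTrivial p-prime}}) (∣⇒≤ (≋0⇒∣ 1≋0))

  coprime : ∀ {a} → ¬ p ∣ a → Coprime p a
  coprime p∤a {d} (d∣p , d∣a) with prime⇒irreducible p-prime d∣p
  ... | inj₁ d≡1  = d≡1
  ... | inj₂ refl = contradiction d∣a p∤a

  inverse : ∀ a → ¬ p ∣ a → Σ ℕ (λ i → i * a ≋ 1)
  inverse a p∤a with coprime-Bézout (coprime p∤a)
  ... | Bézout.-+ x y 1+xp≡ya = y , (begin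
    y * a      ≡⟨ 1+xp≡ya ⟨
    1 + x * p  ≈⟨ +-congˡ≋ 1 (∣⇒≋0 (n∣m*n x)) ⟩
    1 + 0      ∎)
    where open ≋-Reasoning
  ... | Bézout.+- x y 1+ya≡xp = neg y , (begin
    neg y * a          ≡⟨ *-assoc (pred p) y a ⟩
    0 + neg (y * a)    ≈⟨ move (trans (≡⇒≋ 1+ya≡xp) (∣⇒≋0 (n∣m*n x))) ⟨
    1                  ∎)
    where open ≋-Reasoning

  infix 8 _⁻¹

  -- The inverse is used only through its two defining properties, so it is
  -- kept abstract (this also keeps goals small when p ∣? a is analysed).
  abstract
    _⁻¹ : ℕ → ℕ
    a ⁻¹ with p ∣? a
    ... | yes _   = 0
    ... | no p∤a  = proj₁ (inverse a p∤a)

    ⁻¹-inverse : ∀ {a} → ¬ p ∣ a → a ⁻¹ * a ≋ 1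
    ⁻¹-inverse {a} p∤a with p ∣? a
    ... | yes p∣a = contradiction p∣a p∤a
    ... | no p∤a′ = proj₂ (inverse a p∤a′)

    ⁻¹-zero : ∀ {a} → p ∣ a → a ⁻¹ ≡ 0
    ⁻¹-zero {a} p∣a with p ∣? a
    ... | yes _    = refl
    ... | no p∤a   = contradiction p∣a p∤a

  ⁻¹-nonzero : ∀ {a} → ¬ p ∣ a → ¬ p ∣ a ⁻¹
  ⁻¹-nonzero {a} p∤a p∣a⁻¹ =
    1≉0 (trans (sym (⁻¹-inverse p∤a)) (*-congʳ≋ a (∣⇒≋0 p∣a⁻¹)))

  *-⁻¹-zero : ∀ b {a} → p ∣ a → b * a ⁻¹ ≡ 0
  *-⁻¹-zero b p∣a = trans (cong (b *_) (⁻¹-zero p∣a)) (*-zeroʳ b)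

  unscale : ∀ {s u v} → ¬ p ∣ s → u ≋ s * v → s ⁻¹ * u ≋ v
  unscale {s} {u} {v} p∤s u≋sv = begin
    s ⁻¹ * u          ≈⟨ *-congˡ≋ (s ⁻¹) u≋sv ⟩
    s ⁻¹ * (s * v)    ≡⟨ *-assoc (s ⁻¹) s v ⟨
    s ⁻¹ * s * v      ≈⟨ *-congʳ≋ v (⁻¹-inverse p∤s) ⟩
    1 * v             ≡⟨ *-identityˡ v ⟩
    v                 ∎
    where open ≋-Reasoning

  *-cancelʳ≋ : ∀ {a t t′} → ¬ p ∣ a → t * a ≋ t′ * a → t ≋ t′
  *-cancelʳ≋ {a} {t} {t′} p∤a e =
    trans (sym (unscale p∤a (≡⇒≋ (*-comm t a))))
          (unscale p∤a (trans e (≡⇒≋ (*-comm t′ a))))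

module Coordinates (p : ℕ) (p-prime : Prime p) where

  open PrimeField p p-prime

  V3 : Set
  V3 = ℕ × ℕ × ℕ

  infix 4 _≋₃_
  infixr 7 _·₃_
  infixl 6 _+₃_

  _≋₃_ : V3 → V3 → Set
  (a , b , c) ≋₃ (a′ , b′ , c′) = a ≋ a′ × b ≋ b′ × c ≋ c′

  _·₃_ : ℕ → V3 → V3
  k ·₃ (a , b , c) = k * a , k * b , k * c

  _+₃_ : V3 → V3 → V3
  (a , b , c) +₃ (a′ , b′ , c′) = a + a′ , b + b′ , c + c′

  NonZero₃ : V3 → Set
  NonZero₃ (a , b , c) = ¬ (p ∣ a × p ∣ b × p ∣ c)

  toℕ-mod : ∀ a → toℕ (a mod p) ≋ a
  toℕ-mod a = trans (cong (_% p) (toℕ-fromℕ< (m%n<n a p))) (%≋ a)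

  module _ (k : ℕ) where
    factor≋1 : 1 ≋ k * 1 → k ≋ 1
    factor≋1 e = sym (trans e (≡⇒≋ (*-identityʳ k)))

    same : ∀ {a b : Fin p} → k ≋ 1 → toℕ a ≋ k * toℕ b → a ≡ b
    same {a} {b} k≋1 e = toℕ-injective (≋⇒≡ (toℕ<n a) (toℕ<n b)
      (trans e (trans (*-congʳ≋ (toℕ b) k≋1) (≡⇒≋ (*-identityˡ (toℕ b))))))

    1≉k*0 : ¬ 1 ≋ k * 0
    1≉k*0 e = 1≉0 (trans e (≡⇒≋ (*-zeroʳ k)))

    0≋k⇒1≉k* : ∀ {u} → 0 ≋ k * 1 → ¬ 1 ≋ k * u
    0≋k⇒1≉k* {u} e₀ e = 1≉0 (trans e (*-congʳ≋ u (trans (sym (≡⇒≋ (*-identityʳ k))) (sym e₀))))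

  proportional⇒≡ : ∀ (y x : Pt p) k → coords y ≋₃ k ·₃ coords x → y ≡ x
  proportional⇒≡ (pt₁ a b) (pt₁ a′ b′) k (e₀ , e₁ , e₂) = cong₂ pt₁ (same k (factor≋1 k e₀) e₁) (same k (factor≋1 k e₀) e₂)
  proportional⇒≡ (pt₁ _ _) (pt₂ _)     k (e₀ , _)       = ⊥-elim (1≉k*0 k e₀)
  proportional⇒≡ (pt₁ _ _) pt₃         k (e₀ , _)       = ⊥-elim (1≉k*0 k e₀)
  proportional⇒≡ (pt₂ _)   (pt₁ _ _)   k (e₀ , e₁ , _)  = ⊥-elim (0≋k⇒1≉k* k e₀ e₁)
  proportional⇒≡ (pt₂ a)   (pt₂ a′)    k (_ , e₁ , e₂)  = cong pt₂ (same k (factor≋1 k e₁) e₂)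
  proportional⇒≡ (pt₂ _)   pt₃         k (_ , e₁ , _)   = ⊥-elim (1≉k*0 k e₁)
  proportional⇒≡ pt₃       (pt₁ _ _)   k (e₀ , _ , e₂)  = ⊥-elim (0≋k⇒1≉k* k e₀ e₂)
  proportional⇒≡ pt₃       (pt₂ _)     k (_ , e₁ , e₂)  = ⊥-elim (0≋k⇒1≉k* k e₁ e₂)
  proportional⇒≡ pt₃       pt₃         k _              = refl

  toℕ-quotient : ∀ u s → toℕ ((u * s ⁻¹) mod p) ≋ s ⁻¹ * u
  toℕ-quotient u s = trans (toℕ-mod (u * s ⁻¹)) (≡⇒≋ (*-comm u (s ⁻¹)))

  0≋multiple : ∀ k {a} → p ∣ a → 0 ≋ k * a
  0≋multiple k p∣a = sym (trans (*-congˡ≋ k (∣⇒≋0 p∣a)) (≡⇒≋ (*-zeroʳ k)))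

  point : V3 → Pt p
  point (a , b , c) with p ∣? a | p ∣? b
  ... | no _  | _    = pt₁ ((b * a ⁻¹) mod p) ((c * a ⁻¹) mod p)
  ... | yes _ | no _ = pt₂ ((c * b ⁻¹) mod p)
  ... | yes _ | yes _ = pt₃

  point-coords : ∀ v → NonZero₃ v → Σ ℕ (λ s → ¬ p ∣ s × coords (point v) ≋₃ s ·₃ v)
  point-coords (a , b , c) v≢0 with p ∣? a | p ∣? b
  ... | no p∤a | _ =
    a ⁻¹ , ⁻¹-nonzero p∤a , sym (⁻¹-inverse p∤a) , toℕ-quotient b a , toℕ-quotient c a
  ... | yes p∣a | no p∤b =
    b ⁻¹ , ⁻¹-nonzero p∤b , 0≋multiple (b ⁻¹) p∣a , sym (⁻¹-inverse p∤b) , toℕ-quotient c b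
  ... | yes p∣a | yes p∣b with p ∣? c
  ...   | yes p∣c = ⊥-elim (v≢0 (p∣a , p∣b , p∣c))
  ...   | no p∤c  = c ⁻¹ , ⁻¹-nonzero p∤c , 0≋multiple (c ⁻¹) p∣a , 0≋multiple (c ⁻¹) p∣b , sym (⁻¹-inverse p∤c)


  dot-comm : ∀ u v → dot u v ≡ dot v u
  dot-comm (a , b , c) (x , y , z) = cong₂ _+_ (cong₂ _+_ (*-comm a x) (*-comm b y)) (*-comm c z)

  dot-+ʳ : ∀ u v w → dot u (v +₃ w) ≡ dot u v + dot u w
  dot-+ʳ (a , b , c) (x , y , z) (x′ , y′ , z′) = distribute a b c x y z x′ y′ z′
    where
    distribute : ∀ a b c x y z x′ y′ z′ → a * (x + x′) + b * (y + y′) + c * (z + z′) ≡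
                 (a * x + b * y + c * z) + (a * x′ + b * y′ + c * z′)
    distribute = solve-∀

  dot-·ʳ : ∀ u k v → dot u (k ·₃ v) ≡ k * dot u v
  dot-·ʳ (a , b , c) k (x , y , z) = factor-out a b c k x y z
    where
    factor-out : ∀ a b c k x y z → a * (k * x) + b * (k * y) + c * (k * z) ≡ k * (a * x + b * y + c * z)
    factor-out = solve-∀

  dot-scaledʳ : ∀ u {v} s w → v ≋₃ s ·₃ w → dot u v ≋ s * dot u w
  dot-scaledʳ (a , b , c) s w (e₀ , e₁ , e₂) =
    trans (+-cong≋ (+-cong≋ (*-congˡ≋ a e₀) (*-congˡ≋ b e₁)) (*-congˡ≋ c e₂)) (≡⇒≋ (dot-·ʳ (a , b , c) s w))

  dot-scaledˡ : ∀ {u} s v w → u ≋₃ s ·₃ v → dot u w ≋ s * dot v w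
  dot-scaledˡ {u} s v w e =
    trans (≡⇒≋ (dot-comm u w)) (trans (dot-scaledʳ w s v e) (≡⇒≋ (cong (s *_) (dot-comm w v))))

  module _ {z : Pt p} {s : ℕ} {v : V3} (z≋sv : coords z ≋₃ s ·₃ v) (m : Line p) where
    ∈L-scaled⇒ : ¬ p ∣ s → z ∈L m → p ∣ dot (coords m) v
    ∈L-scaled⇒ p∤s z∈m with euclidsLemma s _ p-prime (≋0⇒∣ (trans (sym (dot-scaledʳ (coords m) s v z≋sv)) (∣⇒≋0 z∈m)))
    ... | inj₁ p∣s = contradiction p∣s p∤s
    ... | inj₂ p∣⟨m,v⟩ = p∣⟨m,v⟩

    ∈L-scaled⇐ : p ∣ dot (coords m) v → z ∈L m
    ∈L-scaled⇐ p∣⟨m,v⟩ = ≋0⇒∣ (trans (dot-scaledʳ (coords m) s v z≋sv) (sym (0≋multiple s p∣⟨m,v⟩)))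

  Σ₃ : {A : Set} → List A → (A → V3) → V3
  Σ₃ []       f = 0 , 0 , 0
  Σ₃ (a ∷ as) f = f a +₃ Σ₃ as f

  dot-Σ₃ : ∀ {A : Set} u (as : List A) f → dot u (Σ₃ as f) ≡ Σ-over as (λ a → dot u (f a))
  dot-Σ₃ (u₀ , u₁ , u₂) [] f = cong₂ _+_ (cong₂ _+_ (*-zeroʳ u₀) (*-zeroʳ u₁)) (*-zeroʳ u₂)
  dot-Σ₃ u (a ∷ as) f = trans (dot-+ʳ u (f a) (Σ₃ as f)) (cong (dot u (f a) +_) (dot-Σ₃ u as f))

  NonZero₃-dot : ∀ u w → ¬ p ∣ dot u w → NonZero₃ u
  NonZero₃-dot (u₀ , u₁ , u₂) (w₀ , w₁ , w₂) p∤⟨u,w⟩ (p∣u₀ , p∣u₁ , p∣u₂) =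
    p∤⟨u,w⟩ (∣m∣n⇒∣m+n (∣m∣n⇒∣m+n (∣m⇒∣m*n w₀ p∣u₀) (∣m⇒∣m*n w₁ p∣u₁)) (∣m⇒∣m*n w₂ p∣u₂))

  ∈-point : ∀ u → NonZero₃ u → ∀ y → p ∣ dot u (coords y) → y ∈L point u
  ∈-point u u≢0 y p∣⟨u,y⟩ with point-coords u u≢0
  ... | s , _ , line≋su = ≋0⇒∣ (begin
    dot (coords (point u)) (coords y)   ≈⟨ dot-scaledˡ s u (coords y) line≋su ⟩
    s * dot u (coords y)                ≈⟨ *-congˡ≋ s (∣⇒≋0 p∣⟨u,y⟩) ⟩
    s * 0                               ≡⟨ *-zeroʳ s ⟩
    0                                   ∎)
    where open ≋-Reasoning

-- For fixed a, b consider the congruence b + t·a ≡ 0 in t < p.  (Below, a and b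
-- are the pairings of a line with x and y, and the solutions t are the indices
-- of the points of x ∨ y on that line.)  We evaluate the number of solutions and
-- the sum of the solutions, both as functions of a and b.
module Solutions (p : ℕ) (p-prime : Prime p) where

  open PrimeField p p-prime

  Solves : ℕ → ℕ → ℕ → Set
  Solves a b t = p ∣ b + t * a

  solves? : ∀ a b t → Dec (Solves a b t)
  solves? a b t = p ∣? b + t * a

  root : ℕ → ℕ → ℕ
  root a b = (neg b * a ⁻¹) % p

  root-solves : ∀ {a} b → ¬ p ∣ a → Solves a b (root a b)
  root-solves {a} b p∤a = ≋0⇒∣ (begin
    b + root a b * a             ≈⟨ +-congˡ≋ b (*-congʳ≋ a (%≋ (neg b * a ⁻¹))) ⟩
    b + neg b * a ⁻¹ * a         ≡⟨ cong (b +_) (*-assoc (neg b) (a ⁻¹) a) ⟩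
    b + neg b * (a ⁻¹ * a)       ≈⟨ +-congˡ≋ b (*-congˡ≋ (neg b) (⁻¹-inverse p∤a)) ⟩
    b + neg b * 1                ≡⟨ cong (b +_) (*-identityʳ (neg b)) ⟩
    b + neg b                    ≈⟨ +-neg≋0 b ⟩
    0                            ∎)
    where open ≋-Reasoning

  root-unique : ∀ {a b t} → ¬ p ∣ a → t < p → Solves a b t → t ≡ root a b
  root-unique {a} {b} {t} p∤a t<p t-solves = ≋⇒≡ t<p (m%n<n _ p) (*-cancelʳ≋ p∤a (+-cancelʳ≋ (begin
    t * a + b              ≡⟨ +-comm (t * a) b ⟩
    b + t * a              ≈⟨ ∣⇒≋0 t-solves ⟩
    0                      ≈⟨ ∣⇒≋0 (root-solves b p∤a) ⟨
    b + root a b * a       ≡⟨ +-comm b (root a b * a) ⟩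
    root a b * a + b       ∎)))
    where open ≋-Reasoning

  no-root : ∀ {a b} t → p ∣ a → ¬ p ∣ b → ¬ Solves a b t
  no-root {a} {b} t p∣a p∤b t-solves = p∤b (∣m+n∣m⇒∣n (subst (p ∣_) (+-comm b (t * a)) t-solves) (∣n⇒∣m*n t p∣a))

  every-root : ∀ {a b} t → p ∣ a → p ∣ b → Solves a b t
  every-root t p∣a p∣b = ∣m∣n⇒∣m+n p∣b (∣n⇒∣m*n t p∣a)

  module _ (g : ℕ → ℕ) (a b : ℕ) where
    weighted-solutions : ℕ
    weighted-solutions = Σ< p (λ t → g t * 𝟙 (solves? a b t))

    weighted-unique : ¬ p ∣ a → weighted-solutions ≡ g (root a b)
    weighted-unique p∤a = Σ<-unique p g (solves? a b) (root a b) (m%n<n _ p) (root-solves b p∤a)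
                                    (λ t t<p → root-unique p∤a t<p)

    weighted-none : p ∣ a → ¬ p ∣ b → weighted-solutions ≡ 0
    weighted-none p∣a p∤b = Σ<-none p g (solves? a b) (λ t _ → no-root t p∣a p∤b)

    weighted-all : p ∣ a → p ∣ b → weighted-solutions ≡ Σ< p g
    weighted-all p∣a p∣b = Σ<-cong p (λ t _ → always t)
      where
      always : ∀ t → g t * 𝟙 (solves? a b t) ≡ g t
      always t with solves? a b t
      ... | yes _      = *-identityʳ (g t)
      ... | no ¬solves = contradiction (every-root t p∣a p∣b) ¬solves

  -- the number of solutions is a⁻¹·a: one if a ≢ 0, none or p ≡ 0 otherwise
  solution-count : ∀ a b → weighted-solutions (λ _ → 1) a b ≋ a ⁻¹ * a
  solution-count a b with p ∣? a | p ∣? b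
  ... | no p∤a  | _       = trans (≡⇒≋ (weighted-unique (λ _ → 1) a b p∤a)) (sym (⁻¹-inverse p∤a))
  ... | yes p∣a | no p∤b  = ≡⇒≋ (trans (weighted-none (λ _ → 1) a b p∣a p∤b) (sym (cong (_* a) (⁻¹-zero p∣a))))
  ... | yes p∣a | yes p∣b = trans (≡⇒≋ (weighted-all (λ _ → 1) a b p∣a p∣b))
                                  (trans (∣⇒≋0 (subst (p ∣_) (sym (Σ<-ones p)) ∣-refl))
                                         (≡⇒≋ (sym (cong (_* a) (⁻¹-zero p∣a)))))

  -- 2·(0 + 1 + ⋯ + (p - 1)) = p·(p - 1); for odd p the factor 2 can be dropped
  p∣2·Σ<-id : p ∣ Σ< p (λ t → t) * 2
  p∣2·Σ<-id = subst (λ n → n ∣ Σ< n (λ t → t) * 2) (suc-pred p)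
                (subst (suc (pred p) ∣_) (sym (Σ<-id (pred p))) (∣m⇒∣m*n (pred p) ∣-refl))

  Σ<-id≋0 : p ≢ 2 → Σ< p (λ t → t) ≋ 0
  Σ<-id≋0 p≢2 with euclidsLemma (Σ< p (λ t → t)) 2 p-prime p∣2·Σ<-id
  ... | inj₁ p∣Σ = ∣⇒≋0 p∣Σ
  ... | inj₂ p∣2 with prime⇒irreducible prime[2] p∣2
  ...   | inj₁ p≡1 = contradiction (subst Prime p≡1 p-prime) ¬prime[1]
  ...   | inj₂ p≡2 = contradiction p≡2 p≢2

  solution-sum : p ≢ 2 → ∀ a b → b * a ⁻¹ + weighted-solutions (λ t → t) a b ≋ 0
  solution-sum p≢2 a b with p ∣? a | p ∣? b
  ... | no p∤a  | _       = begin
    b * a ⁻¹ + weighted-solutions (λ t → t) a b   ≡⟨ cong (b * a ⁻¹ +_) (weighted-unique (λ t → t) a b p∤a) ⟩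
    b * a ⁻¹ + root a b                           ≈⟨ +-congˡ≋ (b * a ⁻¹) (%≋ (neg b * a ⁻¹)) ⟩
    b * a ⁻¹ + neg b * a ⁻¹                       ≡⟨ *-distribʳ-+ (a ⁻¹) b (neg b) ⟨
    (b + neg b) * a ⁻¹                            ≈⟨ *-congʳ≋ (a ⁻¹) (+-neg≋0 b) ⟩
    0                                             ∎
    where open ≋-Reasoning
  ... | yes p∣a | no p∤b  = ≡⇒≋ (cong₂ _+_ (*-⁻¹-zero b p∣a) (weighted-none (λ t → t) a b p∣a p∤b))
  ... | yes p∣a | yes p∣b = trans (≡⇒≋ (cong₂ _+_ (*-⁻¹-zero b p∣a) (weighted-all (λ t → t) a b p∣a p∣b)))
                                  (Σ<-id≋0 p≢2)

-- The points of the line x ∨ y other than x are z t = ⟨y + t·x⟩ (t < p), and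
-- z 0 = y.  A line m contains z t iff ⟨m,y⟩ + t·⟨m,x⟩ ≡ 0.
module JoinLine (p : ℕ) (p-prime : Prime p) (x y : Pt p) (y≢x : y ≢ x) where

  open PrimeField p p-prime
  open Coordinates p p-prime
  open Solutions p p-prime

  X Y : V3
  X = coords x
  Y = coords y

  v : ℕ → V3
  v t = Y +₃ t ·₃ X

  -- Scalar forms of "y + t·x is proportional to x, resp. to y"; applied to each
  -- coordinate they show that such a proportionality would force y ≡ x.
  module _ (t y₀ x₀ : ℕ) where
    y+tx≋0 : y₀ + t * x₀ ≋ 0 → y₀ ≋ neg t * x₀
    y+tx≋0 e = trans (move e) (≡⇒≋ (sym (*-assoc (pred p) t x₀)))

    x≋s[y+tx] : ∀ s → ¬ p ∣ s → x₀ ≋ s * (y₀ + t * x₀) → y₀ ≋ (s ⁻¹ + neg t) * x₀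
    x≋s[y+tx] s p∤s e = begin
      y₀                          ≈⟨ move (sym (unscale p∤s e)) ⟩
      s ⁻¹ * x₀ + neg (t * x₀)    ≡⟨ cong (s ⁻¹ * x₀ +_) (*-assoc (pred p) t x₀) ⟨
      s ⁻¹ * x₀ + neg t * x₀      ≡⟨ *-distribʳ-+ x₀ (s ⁻¹) (neg t) ⟨
      (s ⁻¹ + neg t) * x₀         ∎
      where open ≋-Reasoning

    y≋s[y+tx] : ∀ s → ¬ p ∣ s → ¬ p ∣ t → y₀ ≋ s * (y₀ + t * x₀) → x₀ ≋ t ⁻¹ * (s ⁻¹ + neg 1) * y₀
    y≋s[y+tx] s p∤s p∤t e = begin
      x₀                             ≈⟨ unscale p∤t tx≋ ⟨
      t ⁻¹ * ((s ⁻¹ + neg 1) * y₀)   ≡⟨ *-assoc (t ⁻¹) _ y₀ ⟨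
      t ⁻¹ * (s ⁻¹ + neg 1) * y₀     ∎
      where
      open ≋-Reasoning
      tx≋ : (s ⁻¹ + neg 1) * y₀ ≋ t * x₀
      tx≋ = begin
        (s ⁻¹ + neg 1) * y₀          ≡⟨ *-distribʳ-+ y₀ (s ⁻¹) (neg 1) ⟩
        s ⁻¹ * y₀ + neg 1 * y₀       ≡⟨ cong (λ k → s ⁻¹ * y₀ + k * y₀) (*-identityʳ (pred p)) ⟩
        s ⁻¹ * y₀ + neg y₀           ≈⟨ move (trans (≡⇒≋ (+-comm (t * x₀) y₀)) (sym (unscale p∤s e))) ⟨
        t * x₀                       ∎

  module _ (t : ℕ) where
    combination-nonzero : ∀ (U W : V3) → ¬ (U ≋₃ neg t ·₃ W) → NonZero₃ (U +₃ t ·₃ W)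
    combination-nonzero (u₀ , u₁ , u₂) (w₀ , w₁ , w₂) U≉ (d₀ , d₁ , d₂) =
      U≉ (y+tx≋0 t u₀ w₀ (∣⇒≋0 d₀) , y+tx≋0 t u₁ w₁ (∣⇒≋0 d₁) , y+tx≋0 t u₂ w₂ (∣⇒≋0 d₂))

    W≋s[U+tW] : ∀ (U W : V3) s → ¬ p ∣ s → W ≋₃ s ·₃ (U +₃ t ·₃ W) → U ≋₃ (s ⁻¹ + neg t) ·₃ W
    W≋s[U+tW] (u₀ , u₁ , u₂) (w₀ , w₁ , w₂) s p∤s (e₀ , e₁ , e₂) =
      x≋s[y+tx] t u₀ w₀ s p∤s e₀ , x≋s[y+tx] t u₁ w₁ s p∤s e₁ , x≋s[y+tx] t u₂ w₂ s p∤s e₂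

    U≋s[U+tW] : ∀ (U W : V3) s → ¬ p ∣ s → ¬ p ∣ t → U ≋₃ s ·₃ (U +₃ t ·₃ W) →
                W ≋₃ (t ⁻¹ * (s ⁻¹ + neg 1)) ·₃ U
    U≋s[U+tW] (u₀ , u₁ , u₂) (w₀ , w₁ , w₂) s p∤s p∤t (e₀ , e₁ , e₂) =
      y≋s[y+tx] t u₀ w₀ s p∤s p∤t e₀ , y≋s[y+tx] t u₁ w₁ s p∤s p∤t e₁ , y≋s[y+tx] t u₂ w₂ s p∤s p∤t e₂

  +₃-0· : ∀ (U W : V3) → U +₃ 0 ·₃ W ≡ U
  +₃-0· (u₀ , u₁ , u₂) _ = cong₂ _,_ (+-identityʳ u₀) (cong₂ _,_ (+-identityʳ u₁) (+-identityʳ u₂))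

  v-nonzero : ∀ t → NonZero₃ (v t)
  v-nonzero t = combination-nonzero t Y X (λ Y≋ → y≢x (proportional⇒≡ y x (neg t) Y≋))

  z : ℕ → Pt p
  z t = point (v t)

  scale : ℕ → ℕ
  scale t = proj₁ (point-coords (v t) (v-nonzero t))

  scale-nonzero : ∀ t → ¬ p ∣ scale t
  scale-nonzero t = proj₁ (proj₂ (point-coords (v t) (v-nonzero t)))

  z-coords : ∀ t → coords (z t) ≋₃ scale t ·₃ v t
  z-coords t = proj₂ (proj₂ (point-coords (v t) (v-nonzero t)))

  z0≡y : z 0 ≡ y
  z0≡y = proportional⇒≡ (z 0) y (scale 0) (subst (λ V → coords (z 0) ≋₃ scale 0 ·₃ V) (+₃-0· Y X) (z-coords 0))

  z≢x : ∀ t → z t ≢ x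
  z≢x t z≡x = y≢x (proportional⇒≡ y x (scale t ⁻¹ + neg t)
    (W≋s[U+tW] t Y X (scale t) (scale-nonzero t) (subst (λ q → coords q ≋₃ scale t ·₃ v t) z≡x (z-coords t))))

  z≢y : ∀ t → 0 < t → t < p → z t ≢ y
  z≢y t 0<t t<p z≡y = y≢x (sym (proportional⇒≡ x y (t ⁻¹ * (scale t ⁻¹ + neg 1))
    (U≋s[U+tW] t Y X (scale t) (scale-nonzero t) p∤t (subst (λ q → coords q ≋₃ scale t ·₃ v t) z≡y (z-coords t)))))
    where
    p∤t : ¬ p ∣ t
    p∤t p∣t = <⇒≱ t<p (∣⇒≤ {{>-nonZero 0<t}} p∣t)

  dot-v : ∀ (m : Line p) t → dot (coords m) (v t) ≡ dot (coords m) Y + t * dot (coords m) X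
  dot-v m t = trans (dot-+ʳ (coords m) Y (t ·₃ X)) (cong (dot (coords m) Y +_) (dot-·ʳ (coords m) t X))

  z∈L⇔ : ∀ (m : Line p) t → (z t ∈L m → Solves (dot (coords m) X) (dot (coords m) Y) t)
                           × (Solves (dot (coords m) X) (dot (coords m) Y) t → z t ∈L m)
  z∈L⇔ m t = (λ z∈m → subst (p ∣_) (dot-v m t) (∈L-scaled⇒ {z t} {scale t} {v t} (z-coords t) m (scale-nonzero t) z∈m))
           , (λ solves → ∈L-scaled⇐ {z t} {scale t} {v t} (z-coords t) m (subst (p ∣_) (sym (dot-v m t)) solves))

  z∈join : ∀ (ℓ : Line p) t → x ∈L ℓ → y ∈L ℓ → z t ∈L ℓ
  z∈join ℓ t x∈ℓ y∈ℓ = proj₂ (z∈L⇔ ℓ t) (∣m∣n⇒∣m+n y∈ℓ (∣n⇒∣m*n t x∈ℓ))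

-- For the word with coefficients c and the point x put
--     K = Σ_m c(m) · ⟨m,x⟩⁻¹ · m ,
-- where lines m through x contribute nothing because 0⁻¹ = 0.  For every y ≢ x
-- the sums of the word along x ∨ y compute ⟨K,x⟩ and ⟨K,y⟩.
module Candidate (p : ℕ) (p-prime : Prime p) (c : Line p → Fin p) (x : Pt p) where

  open PrimeField p p-prime
  open Coordinates p p-prime
  open Solutions p p-prime

  ⟨_,x⟩ : Line p → ℕ
  ⟨ m ,x⟩ = dot (coords m) (coords x)

  coeff : Line p → ℕ
  coeff m = toℕ (c m)

  lines : List (Line p)
  lines = allLines p

  weight : Line p → ℕ
  weight m = coeff m * ⟨ m ,x⟩ ⁻¹

  K : V3
  K = Σ₃ lines (λ m → weight m ·₃ coords m)

  dot-K : ∀ u → dot K u ≡ Σ-over lines (λ m → weight m * dot (coords m) u)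
  dot-K u = begin
    dot K u                                             ≡⟨ dot-comm K u ⟩
    dot u K                                             ≡⟨ dot-Σ₃ u lines (λ m → weight m ·₃ coords m) ⟩
    Σ-over lines (λ m → dot u (weight m ·₃ coords m))   ≡⟨ Σ-over-cong lines term ⟩
    Σ-over lines (λ m → weight m * dot (coords m) u)    ∎
    where
    open ≡-Reasoning
    term : ∀ m → dot u (weight m ·₃ coords m) ≡ weight m * dot (coords m) u
    term m = trans (dot-·ʳ u (weight m) (coords m)) (cong (weight m *_) (dot-comm u (coords m)))

  module AlongJoin (y : Pt p) (y≢x : y ≢ x) where

    open JoinLine p p-prime x y y≢x

    ⟨_,y⟩ : Line p → ℕ
    ⟨ m ,y⟩ = dot (coords m) (coords y)

    along : (ℕ → ℕ) → Line p → ℕ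
    along g m = weighted-solutions g ⟨ m ,x⟩ ⟨ m ,y⟩

    ind-z : ∀ (m : Line p) t → ind m (z t) ≡ 𝟙 (solves? ⟨ m ,x⟩ ⟨ m ,y⟩ t)
    ind-z m t = trans (ind≡𝟙 m (z t))
                      (𝟙-cong (proj₁ (z∈L⇔ m t)) (proj₂ (z∈L⇔ m t)) (z t ∈L? m) (solves? ⟨ m ,x⟩ ⟨ m ,y⟩ t))

    weighted-word-sum : ∀ g → Σ< p (λ t → g t * wordVal c (z t)) ≡ Σ-over lines (λ m → coeff m * along g m)
    weighted-word-sum g = begin
      Σ< p (λ t → g t * Σ-over lines (λ m → coeff m * ind m (z t)))
        ≡⟨ Σ<-cong p (λ t _ → Σ-over-*ˡ lines (g t) _) ⟨
      Σ< p (λ t → Σ-over lines (λ m → g t * (coeff m * ind m (z t))))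
        ≡⟨ Σ<-Σ-over p lines _ ⟩
      Σ-over lines (λ m → Σ< p (λ t → g t * (coeff m * ind m (z t))))
        ≡⟨ Σ-over-cong lines per-line ⟩
      Σ-over lines (λ m → coeff m * along g m)
        ∎
      where
      open ≡-Reasoning
      per-line : ∀ m → Σ< p (λ t → g t * (coeff m * ind m (z t))) ≡ coeff m * along g m
      per-line m = begin
        Σ< p (λ t → g t * (coeff m * ind m (z t)))   ≡⟨ Σ<-cong p (λ t _ → *-leftComm (g t) (coeff m) _) ⟩
        Σ< p (λ t → coeff m * (g t * ind m (z t)))   ≡⟨ Σ<-*ˡ p (coeff m) _ ⟩
        coeff m * Σ< p (λ t → g t * ind m (z t))     ≡⟨ cong (coeff m *_) (Σ<-cong p (λ t _ → cong (g t *_) (ind-z m t))) ⟩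
        coeff m * along g m                          ∎

    word-sum≋⟨K,x⟩ : Σ< p (λ t → 1 * wordVal c (z t)) ≋ dot K (coords x)
    word-sum≋⟨K,x⟩ = begin
      Σ< p (λ t → 1 * wordVal c (z t))                   ≡⟨ weighted-word-sum (λ _ → 1) ⟩
      Σ-over lines (λ m → coeff m * along (λ _ → 1) m)
        ≈⟨ Σ-over-cong≋ lines (λ m → *-congˡ≋ (coeff m) (solution-count ⟨ m ,x⟩ ⟨ m ,y⟩)) ⟩
      Σ-over lines (λ m → coeff m * (⟨ m ,x⟩ ⁻¹ * ⟨ m ,x⟩))
        ≡⟨ Σ-over-cong lines (λ m → *-assoc (coeff m) _ _) ⟨
      Σ-over lines (λ m → weight m * ⟨ m ,x⟩)            ≡⟨ dot-K (coords x) ⟨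
      dot K (coords x)                                   ∎
      where open ≋-Reasoning

    ⟨K,y⟩+moment≋0 : p ≢ 2 → dot K (coords y) + Σ< p (λ t → t * wordVal c (z t)) ≋ 0
    ⟨K,y⟩+moment≋0 p≢2 = begin
      dot K (coords y) + Σ< p (λ t → t * wordVal c (z t))
        ≡⟨ cong₂ _+_ (dot-K (coords y)) (weighted-word-sum (λ t → t)) ⟩
      Σ-over lines (λ m → weight m * ⟨ m ,y⟩) + Σ-over lines (λ m → coeff m * along (λ t → t) m)
        ≡⟨ Σ-over-+ lines _ _ ⟨
      Σ-over lines (λ m → weight m * ⟨ m ,y⟩ + coeff m * along (λ t → t) m)
        ≈⟨ Σ-over-≋0 lines per-line ⟩
      0 ∎
      where
      open ≋-Reasoning
      per-line : ∀ m → weight m * ⟨ m ,y⟩ + coeff m * along (λ t → t) m ≋ 0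
      per-line m = begin
        coeff m * ⟨ m ,x⟩ ⁻¹ * ⟨ m ,y⟩ + coeff m * S     ≡⟨ cong (_+ coeff m * S) (*-assoc (coeff m) _ _) ⟩
        coeff m * (⟨ m ,x⟩ ⁻¹ * ⟨ m ,y⟩) + coeff m * S   ≡⟨ *-distribˡ-+ (coeff m) _ S ⟨
        coeff m * (⟨ m ,x⟩ ⁻¹ * ⟨ m ,y⟩ + S)             ≡⟨ cong (λ k → coeff m * (k + S)) (*-comm (⟨ m ,x⟩ ⁻¹) _) ⟩
        coeff m * (⟨ m ,y⟩ * ⟨ m ,x⟩ ⁻¹ + S)             ≈⟨ *-congˡ≋ (coeff m) (solution-sum p≢2 ⟨ m ,x⟩ ⟨ m ,y⟩) ⟩
        coeff m * 0                                      ≡⟨ *-zeroʳ (coeff m) ⟩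
        0                                                ∎
        where
        S : ℕ
        S = along (λ t → t) m

  -- A point y ∈ S_x is the only point of S among the z t = ⟨y + t·x⟩:
  -- x ∨ y is a tangent to S (x ∉ S), or a secant meeting S in x and y (x ∈ S).
  record Isolated (y : Pt p) : Set where
    field
      y≢x : y ≢ x
      y∈S : InSupp c y
      others-outside : ∀ t → 0 < t → t < p → p ∣ wordVal c (JoinLine.z p p-prime x y y≢x t)

  isolated : ∀ y → InSx c x y → Isolated y
  isolated y y∈Sx with InSupp? c x
  isolated y (y∈S , y≢x , ℓ , (x∈ℓ , y∈ℓ) , tangent) | no _ = record
    { y≢x = y≢x ; y∈S = y∈S
    ; others-outside = λ t 0<t t<p →
        vanishes-off-saturated-line c ℓ (y ∷ []) ([] ∷ []) ((y∈S , y∈ℓ) ∷ []) tangent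
          (z∈join ℓ t x∈ℓ y∈ℓ) (z≢y t 0<t t<p ∷ [])
    }
    where open JoinLine p p-prime x y y≢x
  isolated y (y∈S , y≢x , ℓ , (x∈ℓ , y∈ℓ) , secant) | yes x∈S = record
    { y≢x = y≢x ; y∈S = y∈S
    ; others-outside = λ t 0<t t<p →
        vanishes-off-saturated-line c ℓ (x ∷ y ∷ []) ((≢-sym y≢x ∷ []) ∷ [] ∷ [])
          ((x∈S , x∈ℓ) ∷ (y∈S , y∈ℓ) ∷ []) secant
          (z∈join ℓ t x∈ℓ y∈ℓ) (z≢x t ∷ z≢y t 0<t t<p ∷ [])
    }
    where open JoinLine p p-prime x y y≢x

  module _ {y : Pt p} (y∈Sx : InSx c x y) where

    open Isolated (isolated y y∈Sx)
    open JoinLine p p-prime x y y≢x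
    open AlongJoin y y≢x

    sum-at-y : ∀ (g : ℕ → ℕ) → Σ< p (λ t → g t * wordVal c (z t)) ≋ g 0 * wordVal c y
    sum-at-y g = begin
      Σ< p f                  ≡⟨ cong (λ n → Σ< n f) (suc-pred p) ⟨
      Σ< (suc (pred p)) f     ≈⟨ Σ<-first (pred p) f vanish ⟩
      g 0 * wordVal c (z 0)   ≡⟨ cong (λ q → g 0 * wordVal c q) z0≡y ⟩
      g 0 * wordVal c y       ∎
      where
      open ≋-Reasoning
      f : ℕ → ℕ
      f t = g t * wordVal c (z t)
      vanish : ∀ t → 0 < t → t < suc (pred p) → f t ≋ 0
      vanish t 0<t t<p = ∣⇒≋0 (∣n⇒∣m*n (g t) (others-outside t 0<t (subst (t <_) (suc-pred p) t<p)))

    ⟨K,x⟩≋w[y] : dot K (coords x) ≋ wordVal c y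
    ⟨K,x⟩≋w[y] = trans (sym word-sum≋⟨K,x⟩) (trans (sum-at-y (λ _ → 1)) (≡⇒≋ (+-identityʳ (wordVal c y))))

    ⟨K,y⟩≋0 : p ≢ 2 → dot K (coords y) ≋ 0
    ⟨K,y⟩≋0 p≢2 = begin
      dot K (coords y)                                        ≡⟨ +-identityʳ _ ⟨
      dot K (coords y) + 0                                    ≈⟨ +-congˡ≋ (dot K (coords y)) (sum-at-y (λ t → t)) ⟨
      dot K (coords y) + Σ< p (λ t → t * wordVal c (z t))     ≈⟨ ⟨K,y⟩+moment≋0 p≢2 ⟩
      0                                                       ∎
      where open ≋-Reasoning

lemma2p4 : (p : ℕ) → Prime p → p ≢ 2 → (c : Line p → Fin p) → (x : Pt p)
    → ∃ (λ (m : Line p) → ∀ (y : Pt p) → InSx c x y → y ∈L m)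
lemma2p4 p p-prime p≢2 c x = S_x⊆line
  where
  open PrimeField p p-prime
  open Coordinates p p-prime
  open Candidate p p-prime c x

  S_x⊆line : ∃ (λ (m : Line p) → ∀ (y : Pt p) → InSx c x y → y ∈L m)
  S_x⊆line with p ∣? dot K (coords x)
  ... | yes p∣⟨K,x⟩ = pt₃ , λ y y∈Sx →
    ⊥-elim (Isolated.y∈S (isolated y y∈Sx) (≋0⇒∣ (trans (sym (⟨K,x⟩≋w[y] y∈Sx)) (∣⇒≋0 p∣⟨K,x⟩))))
  ... | no p∤⟨K,x⟩ = point K , λ y y∈Sx →
    ∈-point K (NonZero₃-dot K (coords x) p∤⟨K,x⟩) y (≋0⇒∣ (⟨K,y⟩≋0 y∈Sx p≢2))
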